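{- Let $\frac{p_1}{q_1}$ and $\frac{p_2}{q_2}$, with $p_i,q_i\in\mathbb{Z}[\sigma]$, be two irreducible fractions. Then the hyperbolic line connecting the points $\frac{p_1}{q_1}$ and $\frac{p_2}{q_2}$ of $\partial\mathbb{H}^3$ is an edge of some fundamental tetrahedron $hT$, $h\in H$, if and only if $l\left(\frac{p_1}{q_1},\frac{p_2}{q_2}\right)=1$.
   Context: Let $\sigma=e^{i\pi/3}=\frac{1+i\sqrt3}{2}$, let $\mathbb{Z}[\sigma]$ be the ring of Eisenstein integers (its units are $\sigma^k$, $k=0,\dots,5$), let $\mathbb{Q}(\sigma)$ be its field of fractions and $\widehat{\mathbb{Q}}(\sigma)=\mathbb{Q}(\sigma)\cup\{\infty\}$. Use the upper half-space model of hyperbolic space $\mathbb{H}^3$, whose boundary is $\widehat{\mathbb{C}}=\mathbb{C}\cup\{\infty\}$. Let $T\subset\mathbb{H}^3$ be the regular ideal tetrahedron with vertices $0,1,\sigma,\infty$ and let $H$ be the group generated by the reflections in the faces of $T$. The images $hT$, $h\in H$, are called fundamental tetrahedra; they tile $\mathbb{H}^3$, and the set of their vertices is $\widehat{\mathbb{Q}}(\sigma)$. A fraction is an expression $p/q$ with $p,q\in\mathbb{Z}[\sigma]$ (not both $0$; $p/0$ represents $\infty$); it is irreducible if whenever $p=kp'$, $q=kq'$ with $k,p',q'\in\mathbb{Z}[\sigma]$ one has $|k|=1$. For irreducible fractions $z_1=p_1/q_1$, $z_2=p_2/q_2$, the det-length is $l(z_1,z_2)=|p_1q_2-p_2q_1|$.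 -}

module Defs where

open import Data.Integer using (ℤ; +_; -_; _+_; _-_; _*_; -[1+_])
open import Data.Fin using (Fin; zero; suc)
open import Data.List using (List; []; _∷_; foldr)
open import Data.Product using (_×_; _,_; Σ; ∃; ∃-syntax)
open import Relation.Binary.PropositionalEquality using (_≡_; _≢_)
open import Relation.Nullary using (¬_)

-- Eisenstein integers  a + b σ,  with σ = e^{iπ/3}, σ² = σ - 1.
record 𝔼 : Set where
  constructor _+_σ
  field
    re : ℤ
    co : ℤ
open 𝔼 public

infixl 6 _⊕_ _⊖_
infixl 7 _⊗_

_⊕_ : 𝔼 → 𝔼 → 𝔼
(a + b σ) ⊕ (c + d σ) = (a + c) + (b + d) σ

⊝_ : 𝔼 → 𝔼
⊝ (a + b σ) = (- a) + (- b) σ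

_⊖_ : 𝔼 → 𝔼 → 𝔼
x ⊖ y = x ⊕ (⊝ y)

-- (a + bσ)(c + dσ) = (ac - bd) + (ad + bc + bd)σ   using σ² = σ - 1
_⊗_ : 𝔼 → 𝔼 → 𝔼
(a + b σ) ⊗ (c + d σ) = (a * c - b * d) + (a * d + b * c + b * d) σ

-- complex conjugation: conj σ = 1 - σ
conj : 𝔼 → 𝔼
conj (a + b σ) = (a + b) + (- b) σ

𝟘 𝟙 σ' : 𝔼
𝟘 = (+ 0) + (+ 0) σ
𝟙 = (+ 1) + (+ 0) σ
σ' = (+ 0) + (+ 1) σ

-- squared modulus |a + bσ|² = a² + ab + b²
norm : 𝔼 → ℤ
norm (a + b σ) = a * a + a * b + b * b

IsUnit : 𝔼 → Set
IsUnit k = norm k ≡ + 1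

Frac : Set
Frac = 𝔼 × 𝔼

Irreducible : Frac → Set
Irreducible (p , q) =
  ¬ (p ≡ 𝟘 × q ≡ 𝟘) ×
  (∀ k p' q' → p ≡ k ⊗ p' → q ≡ k ⊗ q' → IsUnit k)

-- det-length l(p1/q1, p2/q2) = |p1 q2 - p2 q1|; we record its square
detLength² : Frac → Frac → ℤ
detLength² (p₁ , q₁) (p₂ , q₂) = norm (p₁ ⊗ q₂ ⊖ p₂ ⊗ q₁)

_∼_ : Frac → Frac → Set
(p₁ , q₁) ∼ (p₂ , q₂) = p₁ ⊗ q₂ ≡ p₂ ⊗ q₁

-- Boundary action of an anti-Möbius map  z ↦ (A z̄ + B)/(C z̄ + D)
antiMob : 𝔼 → 𝔼 → 𝔼 → 𝔼 → Frac → Frac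
antiMob A B C D (p , q) =
  (A ⊗ conj p ⊕ B ⊗ conj q , C ⊗ conj p ⊕ D ⊗ conj q)

-- The four reflections in the faces of T = (0, 1, σ, ∞), acting on ∂H³:
--  face (0,1,∞):  z ↦ z̄
--  face (0,σ,∞):  z ↦ σ² z̄
--  face (1,σ,∞):  z ↦ (1 + σ) - σ z̄
--  face (0,1,σ):  inversion in the sphere through 0,1,σ:
--                 z ↦ z̄ / ((2 - σ) z̄ + (σ - 1))
reflect : Fin 4 → Frac → Frac
reflect zero = antiMob 𝟙 𝟘 𝟘 𝟙
reflect (suc zero) = antiMob ((-[1+ 0 ]) + (+ 1) σ) 𝟘 𝟘 𝟙
reflect (suc (suc zero)) = antiMob ((+ 0) + (-[1+ 0 ]) σ) ((+ 1) + (+ 1) σ) 𝟘 𝟙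
reflect (suc (suc (suc zero))) =
  antiMob 𝟙 𝟘 ((+ 2) + (-[1+ 0 ]) σ) ((-[1+ 0 ]) + (+ 1) σ)

-- elements of H as words in the generating reflections (all involutions)
H : Set
H = List (Fin 4)

act : H → Frac → Frac
act w z = foldr reflect z w

vertT : Fin 4 → Frac
vertT zero = (𝟘 , 𝟙)
vertT (suc zero) = (𝟙 , 𝟙)
vertT (suc (suc zero)) = (σ' , 𝟙)
vertT (suc (suc (suc zero))) = (𝟙 , 𝟘)

IsFundamentalEdge : Frac → Frac → Set
IsFundamentalEdge z₁ z₂ =
  Σ H λ h → Σ (Fin 4) λ i → Σ (Fin 4) λ j →
    i ≢ j × (act h (vertT i) ∼ z₁) × (act h (vertT j) ∼ z₂)

-- Each generating reflection of H is an anti-Möbius map z ↦ (A z̄ + B)/(C z̄ + D)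
-- with |AD − BC| = 1, so H preserves det-lengths, and the vertices 0, 1, σ, ∞ of T
-- have pairwise det-length 1. A pair with det-length 1 consists of primitive
-- fractions, whose only representatives are their unit multiples; hence the
-- irreducible fractions at the ends of an edge hT have det-length 1.
--
-- Conversely, a descent moves z₁ to a vertex of T: a vertical reflection whose
-- wall separates z from T lowers 9|q|²|z − c|², c the centre of the face (0, 1, σ),
-- without changing |q|, and over that face but inside the circle through 0, 1, σ
-- the reflection in the hemisphere lowers |q|; over the face and outside the circle
-- only the vertices remain. Once z₁ sits at the vertex b, the symmetry τ b of T
-- exchanging b and ∞ makes the denominator of τ b z₂ a unit, and the same descent
-- with the reflections in the faces through b, which fix b, brings z₂ to a vertex.

module Submission where

open import Defs
open import Data.Integer using (+_)
open import Data.Product using (_×_)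
open import Relation.Binary.PropositionalEquality using (_≡_)

open import Algebra.Bundles using (CommutativeRing)
open import Algebra.Structures using (IsCommutativeRing)
import Algebra.Solver.Ring.AlmostCommutativeRing as ACR
import Algebra.Solver.Ring.Simple as RingSolver
open import Data.Empty using (⊥-elim)
open import Data.Fin using (Fin; zero; suc; inject₁)
open import Data.Fin.Properties using (all?; ¬∀⟶∃¬)
open import Data.Integer as ℤ using (ℤ; -[1+_]; 0ℤ; ∣_∣)
import Data.Integer.Properties as ℤ
import Data.Integer.Solver as ℤ-Solver
open import Data.List using (List; []; _∷_; _++_; _∷ʳ_; reverse; foldr)
open import Data.List.Properties using (foldr-++; foldr-∷ʳ; unfold-reverse)
open import Data.Nat as ℕ using (ℕ; zero; suc)
open import Data.Nat.Induction using (<-wellFounded)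
import Data.Nat.Properties as ℕ
import Data.Nat.Solver as ℕ-Solver
open import Data.Product using (_,_; proj₁; proj₂; Σ)
open import Data.Product.Relation.Binary.Lex.Strict using (×-Lex; ×-wellFounded)
open import Data.Sum using (_⊎_; inj₁; inj₂)
open import Data.Unit using (⊤; tt)
open import Function using (_on_; _$_)
open import Induction.WellFounded using (WellFounded; Acc; acc)
open import Relation.Binary.Core using (Rel)
import Relation.Binary.Construct.On as On
open import Relation.Binary.Definitions using (DecidableEquality)
open import Relation.Binary.PropositionalEquality
open import Relation.Nullary using (Dec; yes; no; contradiction)

module ℤS = ℤ-Solver.+-*-Solver
module ℕS = ℕ-Solver.+-*-Solver

pattern ∞          = suc (suc (suc zero))
pattern hemisphere = suc (suc (suc zero))

-- The ring ℤ[σ]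

𝔼-≡ : ∀ {x y : 𝔼} → re x ≡ re y → co x ≡ co y → x ≡ y
𝔼-≡ refl refl = refl

-- A copy of the operations of Defs on pairs of integer polynomials: a
-- polynomial identity between Eisenstein integers is proved by running the
-- integer ring solver on both components of this copy.
module Symbolic {n : ℕ} where
  open ℤS using (Polynomial; con; _:+_; _:*_; _:-_; :-_)

  𝔼ˢ : Set
  𝔼ˢ = Polynomial n × Polynomial n

  infixl 6 _⊕ˢ_ _⊖ˢ_
  infixl 7 _⊗ˢ_

  _⊕ˢ_ _⊖ˢ_ _⊗ˢ_ : 𝔼ˢ → 𝔼ˢ → 𝔼ˢ
  (a , b) ⊕ˢ (c , d) = a :+ c , b :+ d
  (a , b) ⊖ˢ (c , d) = a :+ :- c , b :+ :- d
  (a , b) ⊗ˢ (c , d) = a :* c :- b :* d , a :* d :+ b :* c :+ b :* d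

  ⊝ˢ_ conjˢ : 𝔼ˢ → 𝔼ˢ
  ⊝ˢ (a , b) = :- a , :- b
  conjˢ (a , b) = a :+ b , :- b

  normˢ : 𝔼ˢ → Polynomial n
  normˢ (a , b) = a :* a :+ a :* b :+ b :* b

  ιˢ : ℤ → ℤ → 𝔼ˢ
  ιˢ a b = con a , con b

open Symbolic

⊕-comm : ∀ x y → x ⊕ y ≡ y ⊕ x
⊕-comm x y = 𝔼-≡ (ℤ.+-comm (re x) (re y)) (ℤ.+-comm (co x) (co y))

⊕-assoc : ∀ x y z → (x ⊕ y) ⊕ z ≡ x ⊕ (y ⊕ z)
⊕-assoc x y z = 𝔼-≡ (ℤ.+-assoc (re x) (re y) (re z)) (ℤ.+-assoc (co x) (co y) (co z))

⊕-identityˡ : ∀ x → 𝟘 ⊕ x ≡ x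
⊕-identityˡ x = 𝔼-≡ (ℤ.+-identityˡ (re x)) (ℤ.+-identityˡ (co x))

⊕-identityʳ : ∀ x → x ⊕ 𝟘 ≡ x
⊕-identityʳ x = 𝔼-≡ (ℤ.+-identityʳ (re x)) (ℤ.+-identityʳ (co x))

⊝-inverseˡ : ∀ x → (⊝ x) ⊕ x ≡ 𝟘
⊝-inverseˡ x = 𝔼-≡ (ℤ.+-inverseˡ (re x)) (ℤ.+-inverseˡ (co x))

⊝-inverseʳ : ∀ x → x ⊕ (⊝ x) ≡ 𝟘
⊝-inverseʳ x = 𝔼-≡ (ℤ.+-inverseʳ (re x)) (ℤ.+-inverseʳ (co x))

⊗-comm : ∀ x y → x ⊗ y ≡ y ⊗ x
⊗-comm (a + b σ) (c + d σ) = 𝔼-≡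
  (solve 4 (λ a b c d → proj₁ ((a , b) ⊗ˢ (c , d)) := proj₁ ((c , d) ⊗ˢ (a , b))) refl a b c d)
  (solve 4 (λ a b c d → proj₂ ((a , b) ⊗ˢ (c , d)) := proj₂ ((c , d) ⊗ˢ (a , b))) refl a b c d)
  where open ℤS

⊗-assoc : ∀ x y z → (x ⊗ y) ⊗ z ≡ x ⊗ (y ⊗ z)
⊗-assoc (a + b σ) (c + d σ) (e + f σ) = 𝔼-≡
  (solve 6 (λ a b c d e f → proj₁ ((a , b) ⊗ˢ (c , d) ⊗ˢ (e , f)) := proj₁ ((a , b) ⊗ˢ ((c , d) ⊗ˢ (e , f)))) refl a b c d e f)
  (solve 6 (λ a b c d e f → proj₂ ((a , b) ⊗ˢ (c , d) ⊗ˢ (e , f)) := proj₂ ((a , b) ⊗ˢ ((c , d) ⊗ˢ (e , f)))) refl a b c d e f)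
  where open ℤS

⊗-identityˡ : ∀ x → 𝟙 ⊗ x ≡ x
⊗-identityˡ (a + b σ) = 𝔼-≡
  (solve 2 (λ a b → proj₁ (ιˢ (+ 1) (+ 0) ⊗ˢ (a , b)) := a) refl a b)
  (solve 2 (λ a b → proj₂ (ιˢ (+ 1) (+ 0) ⊗ˢ (a , b)) := b) refl a b)
  where open ℤS

⊗-identityʳ : ∀ x → x ⊗ 𝟙 ≡ x
⊗-identityʳ x = trans (⊗-comm x 𝟙) (⊗-identityˡ x)

⊗-distribˡ-⊕ : ∀ x y z → x ⊗ (y ⊕ z) ≡ x ⊗ y ⊕ x ⊗ z
⊗-distribˡ-⊕ (a + b σ) (c + d σ) (e + f σ) = 𝔼-≡
  (solve 6 (λ a b c d e f → proj₁ ((a , b) ⊗ˢ ((c , d) ⊕ˢ (e , f))) := proj₁ ((a , b) ⊗ˢ (c , d) ⊕ˢ (a , b) ⊗ˢ (e , f))) refl a b c d e f)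
  (solve 6 (λ a b c d e f → proj₂ ((a , b) ⊗ˢ ((c , d) ⊕ˢ (e , f))) := proj₂ ((a , b) ⊗ˢ (c , d) ⊕ˢ (a , b) ⊗ˢ (e , f))) refl a b c d e f)
  where open ℤS

⊗-distribʳ-⊕ : ∀ x y z → (y ⊕ z) ⊗ x ≡ y ⊗ x ⊕ z ⊗ x
⊗-distribʳ-⊕ x y z = begin
  (y ⊕ z) ⊗ x     ≡⟨ ⊗-comm (y ⊕ z) x ⟩
  x ⊗ (y ⊕ z)     ≡⟨ ⊗-distribˡ-⊕ x y z ⟩
  x ⊗ y ⊕ x ⊗ z   ≡⟨ cong₂ _⊕_ (⊗-comm x y) (⊗-comm x z) ⟩
  y ⊗ x ⊕ z ⊗ x   ∎
  where open ≡-Reasoning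

_≟_ : DecidableEquality 𝔼
(a + b σ) ≟ (c + d σ) with a ℤ.≟ c | b ℤ.≟ d
... | yes refl | yes refl = yes refl
... | no a≢c   | _        = no λ x≡y → a≢c (cong re x≡y)
... | yes _    | no b≢d   = no λ x≡y → b≢d (cong co x≡y)

⊕-⊗-isCommutativeRing : IsCommutativeRing _≡_ _⊕_ _⊗_ ⊝_ 𝟘 𝟙
⊕-⊗-isCommutativeRing = record
  { isRing = record
    { +-isAbelianGroup = record
      { isGroup = record
        { isMonoid = record
          { isSemigroup = record
            { isMagma = record { isEquivalence = isEquivalence ; ∙-cong = cong₂ _⊕_ }
            ; assoc = ⊕-assoc }
          ; identity = ⊕-identityˡ , ⊕-identityʳ }
        ; inverse = ⊝-inverseˡ , ⊝-inverseʳ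
        ; ⁻¹-cong = cong ⊝_ }
      ; comm = ⊕-comm }
    ; *-cong = cong₂ _⊗_
    ; *-assoc = ⊗-assoc
    ; *-identity = ⊗-identityˡ , ⊗-identityʳ
    ; distrib = ⊗-distribˡ-⊕ , ⊗-distribʳ-⊕ }
  ; *-comm = ⊗-comm }

⊕-⊗-commutativeRing : CommutativeRing _ _
⊕-⊗-commutativeRing = record { isCommutativeRing = ⊕-⊗-isCommutativeRing }

module 𝔼S = RingSolver (ACR.fromCommutativeRing ⊕-⊗-commutativeRing) _≟_

fromℤ : ℤ → 𝔼
fromℤ n = n + (+ 0) σ

conj-⊕ : ∀ x y → conj (x ⊕ y) ≡ conj x ⊕ conj y
conj-⊕ (a + b σ) (c + d σ) = 𝔼-≡
  (solve 4 (λ a b c d → proj₁ (conjˢ ((a , b) ⊕ˢ (c , d))) := proj₁ (conjˢ (a , b) ⊕ˢ conjˢ (c , d))) refl a b c d)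
  (solve 4 (λ a b c d → proj₂ (conjˢ ((a , b) ⊕ˢ (c , d))) := proj₂ (conjˢ (a , b) ⊕ˢ conjˢ (c , d))) refl a b c d)
  where open ℤS

conj-⊝ : ∀ x → conj (⊝ x) ≡ ⊝ conj x
conj-⊝ (a + b σ) = 𝔼-≡
  (solve 2 (λ a b → proj₁ (conjˢ (⊝ˢ (a , b))) := proj₁ (⊝ˢ conjˢ (a , b))) refl a b)
  (solve 2 (λ a b → proj₂ (conjˢ (⊝ˢ (a , b))) := proj₂ (⊝ˢ conjˢ (a , b))) refl a b)
  where open ℤS

conj-⊖ : ∀ x y → conj (x ⊖ y) ≡ conj x ⊖ conj y
conj-⊖ x y = trans (conj-⊕ x (⊝ y)) (cong (conj x ⊕_) (conj-⊝ y))

conj-⊗ : ∀ x y → conj (x ⊗ y) ≡ conj x ⊗ conj y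
conj-⊗ (a + b σ) (c + d σ) = 𝔼-≡
  (solve 4 (λ a b c d → proj₁ (conjˢ ((a , b) ⊗ˢ (c , d))) := proj₁ (conjˢ (a , b) ⊗ˢ conjˢ (c , d))) refl a b c d)
  (solve 4 (λ a b c d → proj₂ (conjˢ ((a , b) ⊗ˢ (c , d))) := proj₂ (conjˢ (a , b) ⊗ˢ conjˢ (c , d))) refl a b c d)
  where open ℤS

conj-involutive : ∀ x → conj (conj x) ≡ x
conj-involutive (a + b σ) = 𝔼-≡
  (solve 2 (λ a b → proj₁ (conjˢ (conjˢ (a , b))) := a) refl a b)
  (solve 2 (λ a b → proj₂ (conjˢ (conjˢ (a , b))) := b) refl a b)
  where open ℤS

conj-⊗-self : ∀ x → conj x ⊗ x ≡ fromℤ (norm x)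
conj-⊗-self (a + b σ) = 𝔼-≡
  (solve 2 (λ a b → proj₁ (conjˢ (a , b) ⊗ˢ (a , b)) := normˢ (a , b)) refl a b)
  (solve 2 (λ a b → proj₂ (conjˢ (a , b) ⊗ˢ (a , b)) := con (+ 0)) refl a b)
  where open ℤS

norm-⊗ : ∀ x y → norm (x ⊗ y) ≡ norm x ℤ.* norm y
norm-⊗ (a + b σ) (c + d σ) =
  solve 4 (λ a b c d → normˢ ((a , b) ⊗ˢ (c , d)) := normˢ (a , b) :* normˢ (c , d)) refl a b c d
  where open ℤS

norm-conj : ∀ x → norm (conj x) ≡ norm x
norm-conj (a + b σ) = solve 2 (λ a b → normˢ (conjˢ (a , b)) := normˢ (a , b)) refl a b
  where open ℤS

norm-⊝ : ∀ x → norm (⊝ x) ≡ norm x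
norm-⊝ (a + b σ) = solve 2 (λ a b → normˢ (⊝ˢ (a , b)) := normˢ (a , b)) refl a b
  where open ℤS

four-norm : ∀ a b → + 4 ℤ.* norm (a + b σ) ≡ (+ 2 ℤ.* a ℤ.+ b) ℤ.* (+ 2 ℤ.* a ℤ.+ b) ℤ.+ + 3 ℤ.* (b ℤ.* b)
four-norm = solve 2 (λ a b → con (+ 4) :* normˢ (a , b) := (con (+ 2) :* a :+ b) :* (con (+ 2) :* a :+ b) :+ con (+ 3) :* (b :* b)) refl
  where open ℤS

square-nonNeg : ∀ i → 0ℤ ℤ.≤ i ℤ.* i
square-nonNeg (+ n)      = subst (0ℤ ℤ.≤_) (ℤ.pos-* n n) (ℤ.+≤+ ℕ.z≤n)
square-nonNeg -[1+ n ]  = ℤ.+≤+ ℕ.z≤n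

square≡0⇒≡0 : ∀ i → i ℤ.* i ≡ 0ℤ → i ≡ 0ℤ
square≡0⇒≡0 i eq with ℤ.i*j≡0⇒i≡0∨j≡0 i eq
... | inj₁ i≡0 = i≡0
... | inj₂ i≡0 = i≡0

nonNeg-sum≡0 : ∀ {i j} → 0ℤ ℤ.≤ i → 0ℤ ℤ.≤ j → i ℤ.+ j ≡ 0ℤ → i ≡ 0ℤ × j ≡ 0ℤ
nonNeg-sum≡0 {+ m} {+ n} _ _ eq
  with ℕ.m+n≡0⇒m≡0 m (ℤ.+-injective eq) | ℕ.m+n≡0⇒n≡0 m (ℤ.+-injective eq)
... | refl | refl = refl , refl

norm-nonNeg : ∀ x → 0ℤ ℤ.≤ norm x
norm-nonNeg (a + b σ) = ℤ.*-cancelˡ-≤-pos 0ℤ _ (+ 4) (subst (0ℤ ℤ.≤_) (sym (four-norm a b))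
  (ℤ.+-mono-≤ (square-nonNeg (+ 2 ℤ.* a ℤ.+ b)) (ℤ.*-monoˡ-≤-nonNeg (+ 3) (square-nonNeg b))))

norm≡0⇒≡𝟘 : ∀ x → norm x ≡ 0ℤ → x ≡ 𝟘
norm≡0⇒≡𝟘 (a + b σ) eq = 𝔼-≡ a≡0 b≡0
  where
  squares≡0 : (+ 2 ℤ.* a ℤ.+ b) ℤ.* (+ 2 ℤ.* a ℤ.+ b) ℤ.+ + 3 ℤ.* (b ℤ.* b) ≡ 0ℤ
  squares≡0 = trans (sym (four-norm a b)) (cong (+ 4 ℤ.*_) eq)
  parts = nonNeg-sum≡0 (square-nonNeg (+ 2 ℤ.* a ℤ.+ b))
    (ℤ.*-monoˡ-≤-nonNeg (+ 3) (square-nonNeg b)) squares≡0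
  b≡0 : b ≡ 0ℤ
  b≡0 = square≡0⇒≡0 b (ℤ.*-cancelˡ-≡ (+ 3) _ 0ℤ (proj₂ parts))
  a≡0 : a ≡ 0ℤ
  a≡0 = ℤ.*-cancelˡ-≡ (+ 2) a 0ℤ (begin
    + 2 ℤ.* a            ≡⟨ ℤ.+-identityʳ (+ 2 ℤ.* a) ⟨
    + 2 ℤ.* a ℤ.+ 0ℤ     ≡⟨ cong (λ t → + 2 ℤ.* a ℤ.+ t) b≡0 ⟨
    + 2 ℤ.* a ℤ.+ b      ≡⟨ square≡0⇒≡0 _ (proj₁ parts) ⟩
    0ℤ                   ∎)
    where open ≡-Reasoning

⊗-cancelˡ : ∀ {x y z} → x ≢ 𝟘 → x ⊗ y ≡ x ⊗ z → y ≡ z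
⊗-cancelˡ {x} {y} {z} x≢𝟘 eq = conclude (ℤ.i*j≡0⇒i≡0∨j≡0 (norm x) norm-product≡0)
  where
  open ≡-Reasoning
  difference : x ⊗ (y ⊖ z) ≡ x ⊗ y ⊖ x ⊗ z
  difference = 𝔼S.solve 3 (λ x y z → x 𝔼S.:* (y 𝔼S.:- z) 𝔼S.:= x 𝔼S.:* y 𝔼S.:- x 𝔼S.:* z) refl x y z
  norm-product≡0 : norm x ℤ.* norm (y ⊖ z) ≡ 0ℤ
  norm-product≡0 = begin
    norm x ℤ.* norm (y ⊖ z)   ≡⟨ norm-⊗ x (y ⊖ z) ⟨
    norm (x ⊗ (y ⊖ z))        ≡⟨ cong norm (trans difference (cong (_⊖ x ⊗ z) eq)) ⟩
    norm (x ⊗ z ⊖ x ⊗ z)      ≡⟨ cong norm (⊝-inverseʳ (x ⊗ z)) ⟩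
    0ℤ                        ∎
  conclude : norm x ≡ 0ℤ ⊎ norm (y ⊖ z) ≡ 0ℤ → y ≡ z
  conclude (inj₁ norm-x≡0)   = ⊥-elim (x≢𝟘 (norm≡0⇒≡𝟘 x norm-x≡0))
  conclude (inj₂ norm-y-z≡0) = begin
    y             ≡⟨ 𝔼S.solve 2 (λ y z → y 𝔼S.:= (y 𝔼S.:- z) 𝔼S.:+ z) refl y z ⟩
    (y ⊖ z) ⊕ z   ≡⟨ cong (_⊕ z) (norm≡0⇒≡𝟘 (y ⊖ z) norm-y-z≡0) ⟩
    𝟘 ⊕ z         ≡⟨ ⊕-identityˡ z ⟩
    z             ∎

IsUnit-⊗⇒IsUnitʳ : ∀ x y → IsUnit (x ⊗ y) → IsUnit y
IsUnit-⊗⇒IsUnitʳ x y xy-unit = trans (sym (ℤ.0≤i⇒+∣i∣≡i (norm-nonNeg y))) (cong +_ ∣norm-y∣≡1)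
  where
  ∣norm-y∣≡1 : ∣ norm y ∣ ≡ 1
  ∣norm-y∣≡1 = ℕ.m*n≡1⇒n≡1 ∣ norm x ∣ ∣ norm y ∣
    (trans (sym (ℤ.abs-* (norm x) (norm y))) (cong ∣_∣ (trans (sym (norm-⊗ x y)) xy-unit)))

-- Anti-Möbius maps and the action of H

det : Frac → Frac → 𝔼
det (p₁ , q₁) (p₂ , q₂) = p₁ ⊗ q₂ ⊖ p₂ ⊗ q₁

det-antiMob : ∀ A B C D z w →
  det (antiMob A B C D z) (antiMob A B C D w) ≡ (A ⊗ D ⊖ B ⊗ C) ⊗ conj (det z w)
det-antiMob A B C D (p₁ , q₁) (p₂ , q₂) = begin
  det (antiMob A B C D (p₁ , q₁)) (antiMob A B C D (p₂ , q₂))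
    ≡⟨ solve 8 (λ A B C D p₁ q₁ p₂ q₂ →
         (A :* p₁ :+ B :* q₁) :* (C :* p₂ :+ D :* q₂) :- (A :* p₂ :+ B :* q₂) :* (C :* p₁ :+ D :* q₁)
           := (A :* D :- B :* C) :* (p₁ :* q₂ :- p₂ :* q₁))
         refl A B C D (conj p₁) (conj q₁) (conj p₂) (conj q₂) ⟩
  (A ⊗ D ⊖ B ⊗ C) ⊗ (conj p₁ ⊗ conj q₂ ⊖ conj p₂ ⊗ conj q₁)
    ≡⟨ cong ((A ⊗ D ⊖ B ⊗ C) ⊗_) conj-det ⟨
  (A ⊗ D ⊖ B ⊗ C) ⊗ conj (det (p₁ , q₁) (p₂ , q₂)) ∎
  where
  open ≡-Reasoning; open 𝔼S
  conj-det : conj (p₁ ⊗ q₂ ⊖ p₂ ⊗ q₁) ≡ conj p₁ ⊗ conj q₂ ⊖ conj p₂ ⊗ conj q₁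
  conj-det = trans (conj-⊖ (p₁ ⊗ q₂) (p₂ ⊗ q₁)) (cong₂ _⊖_ (conj-⊗ p₁ q₂) (conj-⊗ p₂ q₁))

norm-det-antiMob : ∀ A B C D → IsUnit (A ⊗ D ⊖ B ⊗ C) → ∀ z w →
  detLength² (antiMob A B C D z) (antiMob A B C D w) ≡ detLength² z w
norm-det-antiMob A B C D unit z w = begin
  norm (det (antiMob A B C D z) (antiMob A B C D w))   ≡⟨ cong norm (det-antiMob A B C D z w) ⟩
  norm ((A ⊗ D ⊖ B ⊗ C) ⊗ conj (det z w))              ≡⟨ norm-⊗ (A ⊗ D ⊖ B ⊗ C) (conj (det z w)) ⟩
  norm (A ⊗ D ⊖ B ⊗ C) ℤ.* norm (conj (det z w))       ≡⟨ cong₂ ℤ._*_ unit (norm-conj (det z w)) ⟩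
  + 1 ℤ.* norm (det z w)                                ≡⟨ ℤ.*-identityˡ (norm (det z w)) ⟩
  norm (det z w)                                        ∎
  where open ≡-Reasoning

conj-antiMob-row : ∀ X Y p q → conj (X ⊗ conj p ⊕ Y ⊗ conj q) ≡ conj X ⊗ p ⊕ conj Y ⊗ q
conj-antiMob-row X Y p q = begin
  conj (X ⊗ conj p ⊕ Y ⊗ conj q)                        ≡⟨ conj-⊕ (X ⊗ conj p) (Y ⊗ conj q) ⟩
  conj (X ⊗ conj p) ⊕ conj (Y ⊗ conj q)                 ≡⟨ cong₂ _⊕_ (conj-⊗ X (conj p)) (conj-⊗ Y (conj q)) ⟩
  conj X ⊗ conj (conj p) ⊕ conj Y ⊗ conj (conj q)       ≡⟨ cong₂ (λ s t → conj X ⊗ s ⊕ conj Y ⊗ t) (conj-involutive p) (conj-involutive q) ⟩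
  conj X ⊗ p ⊕ conj Y ⊗ q                               ∎
  where open ≡-Reasoning

Matrix : Set
Matrix = 𝔼 × 𝔼 × 𝔼 × 𝔼

applyMatrix : Matrix → Frac → Frac
applyMatrix (a , b , c , d) (p , q) = a ⊗ p ⊕ b ⊗ q , c ⊗ p ⊕ d ⊗ q

applyMatrix-identity : ∀ z → applyMatrix (𝟙 , 𝟘 , 𝟘 , 𝟙) z ≡ z
applyMatrix-identity (p , q) = cong₂ _,_
  (solve 2 (λ p q → con 𝟙 :* p :+ con 𝟘 :* q := p) refl p q)
  (solve 2 (λ p q → con 𝟘 :* p :+ con 𝟙 :* q := q) refl p q)
  where open 𝔼S

M·M̄ : 𝔼 → 𝔼 → 𝔼 → 𝔼 → Matrix
M·M̄ A B C D =
  A ⊗ conj A ⊕ B ⊗ conj C , A ⊗ conj B ⊕ B ⊗ conj D , C ⊗ conj A ⊕ D ⊗ conj C , C ⊗ conj B ⊕ D ⊗ conj D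

antiMob-antiMob : ∀ A B C D z → antiMob A B C D (antiMob A B C D z) ≡ applyMatrix (M·M̄ A B C D) z
antiMob-antiMob A B C D (p , q) = cong₂ _,_ (row A B) (row C D)
  where
  row : ∀ X Y → X ⊗ conj (A ⊗ conj p ⊕ B ⊗ conj q) ⊕ Y ⊗ conj (C ⊗ conj p ⊕ D ⊗ conj q)
              ≡ (X ⊗ conj A ⊕ Y ⊗ conj C) ⊗ p ⊕ (X ⊗ conj B ⊕ Y ⊗ conj D) ⊗ q
  row X Y = begin
    X ⊗ conj (A ⊗ conj p ⊕ B ⊗ conj q) ⊕ Y ⊗ conj (C ⊗ conj p ⊕ D ⊗ conj q)
      ≡⟨ cong₂ (λ s t → X ⊗ s ⊕ Y ⊗ t) (conj-antiMob-row A B p q) (conj-antiMob-row C D p q) ⟩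
    X ⊗ (conj A ⊗ p ⊕ conj B ⊗ q) ⊕ Y ⊗ (conj C ⊗ p ⊕ conj D ⊗ q)
      ≡⟨ solve 8 (λ X Y A B C D p q → X :* (A :* p :+ B :* q) :+ Y :* (C :* p :+ D :* q)
                   := (X :* A :+ Y :* C) :* p :+ (X :* B :+ Y :* D) :* q)
           refl X Y (conj A) (conj B) (conj C) (conj D) p q ⟩
    (X ⊗ conj A ⊕ Y ⊗ conj C) ⊗ p ⊕ (X ⊗ conj B ⊕ Y ⊗ conj D) ⊗ q ∎
    where open ≡-Reasoning; open 𝔼S

_·_ : 𝔼 → Frac → Frac
k · (p , q) = k ⊗ p , k ⊗ q

Multiple : Frac → Frac → Set
Multiple w z = Σ 𝔼 λ k → z ≡ k · w

Multiple-trans : ∀ {u v w} → Multiple u v → Multiple v w → Multiple u w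
Multiple-trans {p , q} (k , refl) (l , refl) = l ⊗ k , cong₂ _,_ (sym (⊗-assoc l k p)) (sym (⊗-assoc l k q))

Multiple⇒∼ : ∀ {w z} → Multiple w z → w ∼ z
Multiple⇒∼ {p , q} (k , refl) = solve 3 (λ k p q → p :* (k :* q) := k :* p :* q) refl k p q
  where open 𝔼S

antiMob-· : ∀ A B C D k z → antiMob A B C D (k · z) ≡ conj k · antiMob A B C D z
antiMob-· A B C D k (p , q) = cong₂ _,_ (row A B) (row C D)
  where
  row : ∀ X Y → X ⊗ conj (k ⊗ p) ⊕ Y ⊗ conj (k ⊗ q) ≡ conj k ⊗ (X ⊗ conj p ⊕ Y ⊗ conj q)
  row X Y = begin
    X ⊗ conj (k ⊗ p) ⊕ Y ⊗ conj (k ⊗ q)             ≡⟨ cong₂ (λ s t → X ⊗ s ⊕ Y ⊗ t) (conj-⊗ k p) (conj-⊗ k q) ⟩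
    X ⊗ (conj k ⊗ conj p) ⊕ Y ⊗ (conj k ⊗ conj q)   ≡⟨ solve 5 (λ X Y k̄ p̄ q̄ → X :* (k̄ :* p̄) :+ Y :* (k̄ :* q̄)
                                                                              := k̄ :* (X :* p̄ :+ Y :* q̄))
                                                             refl X Y (conj k) (conj p) (conj q) ⟩
    conj k ⊗ (X ⊗ conj p ⊕ Y ⊗ conj q)              ∎
    where open ≡-Reasoning; open 𝔼S

record IsAntiMöbiusInvolution (f : Frac → Frac) : Set where
  field
    A B C D    : 𝔼
    f≗antiMob  : ∀ z → f z ≡ antiMob A B C D z
    det-isUnit : IsUnit (A ⊗ D ⊖ B ⊗ C)
    M·M̄≡I      : M·M̄ A B C D ≡ (𝟙 , 𝟘 , 𝟘 , 𝟙)

module AntiMöbiusInvolution {f : Frac → Frac} (isAMI : IsAntiMöbiusInvolution f) where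
  open IsAntiMöbiusInvolution isAMI

  involutive : ∀ z → f (f z) ≡ z
  involutive z = begin
    f (f z)                               ≡⟨ f≗antiMob (f z) ⟩
    antiMob A B C D (f z)                 ≡⟨ cong (antiMob A B C D) (f≗antiMob z) ⟩
    antiMob A B C D (antiMob A B C D z)   ≡⟨ antiMob-antiMob A B C D z ⟩
    applyMatrix (M·M̄ A B C D) z           ≡⟨ cong (λ M → applyMatrix M z) M·M̄≡I ⟩
    applyMatrix (𝟙 , 𝟘 , 𝟘 , 𝟙) z         ≡⟨ applyMatrix-identity z ⟩
    z                                     ∎
    where open ≡-Reasoning

  preserves-detLength² : ∀ z w → detLength² (f z) (f w) ≡ detLength² z w
  preserves-detLength² z w = subst₂ (λ z′ w′ → detLength² z′ w′ ≡ detLength² z w)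
    (sym (f≗antiMob z)) (sym (f≗antiMob w)) (norm-det-antiMob A B C D det-isUnit z w)

  preserves-Multiple : ∀ {w z} → Multiple w z → Multiple (f w) (f z)
  preserves-Multiple {w} (k , refl) = conj k , (begin
    f (k · w)                   ≡⟨ f≗antiMob (k · w) ⟩
    antiMob A B C D (k · w)     ≡⟨ antiMob-· A B C D k w ⟩
    conj k · antiMob A B C D w  ≡⟨ cong (conj k ·_) (f≗antiMob w) ⟨
    conj k · f w                ∎)
    where open ≡-Reasoning

reflect-isAntiMöbiusInvolution : ∀ r → IsAntiMöbiusInvolution (reflect r)
reflect-isAntiMöbiusInvolution zero = record
  { A = 𝟙 ; B = 𝟘 ; C = 𝟘 ; D = 𝟙
  ; f≗antiMob = λ _ → refl ; det-isUnit = refl ; M·M̄≡I = refl }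
reflect-isAntiMöbiusInvolution (suc zero) = record
  { A = (-[1+ 0 ]) + (+ 1) σ ; B = 𝟘 ; C = 𝟘 ; D = 𝟙
  ; f≗antiMob = λ _ → refl ; det-isUnit = refl ; M·M̄≡I = refl }
reflect-isAntiMöbiusInvolution (suc (suc zero)) = record
  { A = (+ 0) + (-[1+ 0 ]) σ ; B = (+ 1) + (+ 1) σ ; C = 𝟘 ; D = 𝟙
  ; f≗antiMob = λ _ → refl ; det-isUnit = refl ; M·M̄≡I = refl }
reflect-isAntiMöbiusInvolution hemisphere = record
  { A = 𝟙 ; B = 𝟘 ; C = (+ 2) + (-[1+ 0 ]) σ ; D = (-[1+ 0 ]) + (+ 1) σ
  ; f≗antiMob = λ _ → refl ; det-isUnit = refl ; M·M̄≡I = refl }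

module Reflect (r : Fin 4) = AntiMöbiusInvolution (reflect-isAntiMöbiusInvolution r)

detLength²-act : ∀ h z w → detLength² (act h z) (act h w) ≡ detLength² z w
detLength²-act []      z w = refl
detLength²-act (r ∷ h) z w = trans (Reflect.preserves-detLength² r (act h z) (act h w)) (detLength²-act h z w)

act-Multiple : ∀ h {w z} → Multiple w z → Multiple (act h w) (act h z)
act-Multiple []      m = m
act-Multiple (r ∷ h) m = Reflect.preserves-Multiple r (act-Multiple h m)

act-++ : ∀ g h z → act (g ++ h) z ≡ act g (act h z)
act-++ g h z = foldr-++ reflect z g h

act-reverse : ∀ h z → act (reverse h) (act h z) ≡ z
act-reverse []      z = refl
act-reverse (r ∷ h) z = begin
  act (reverse (r ∷ h)) (reflect r (act h z))
    ≡⟨ cong (λ g → act g (reflect r (act h z))) (unfold-reverse r h) ⟩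
  foldr reflect (reflect r (act h z)) (reverse h ∷ʳ r)
    ≡⟨ foldr-∷ʳ reflect (reflect r (act h z)) r (reverse h) ⟩
  act (reverse h) (reflect r (reflect r (act h z)))
    ≡⟨ cong (act (reverse h)) (Reflect.involutive r (act h z)) ⟩
  act (reverse h) (act h z)
    ≡⟨ act-reverse h z ⟩
  z ∎
  where open ≡-Reasoning

-- Edges of fundamental tetrahedra have det-length 1

vertT-unimodular : ∀ i j → i ≢ j → detLength² (vertT i) (vertT j) ≡ + 1
vertT-unimodular zero             zero             i≢j = contradiction refl i≢j
vertT-unimodular zero             (suc zero)       _   = refl
vertT-unimodular zero             (suc (suc zero)) _   = refl
vertT-unimodular zero             ∞                _   = refl
vertT-unimodular (suc zero)       zero             _   = refl
vertT-unimodular (suc zero)       (suc zero)       i≢j = contradiction refl i≢j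
vertT-unimodular (suc zero)       (suc (suc zero)) _   = refl
vertT-unimodular (suc zero)       ∞                _   = refl
vertT-unimodular (suc (suc zero)) zero             _   = refl
vertT-unimodular (suc (suc zero)) (suc zero)       _   = refl
vertT-unimodular (suc (suc zero)) (suc (suc zero)) i≢j = contradiction refl i≢j
vertT-unimodular (suc (suc zero)) ∞                _   = refl
vertT-unimodular ∞                zero             _   = refl
vertT-unimodular ∞                (suc zero)       _   = refl
vertT-unimodular ∞                (suc (suc zero)) _   = refl
vertT-unimodular ∞                ∞                i≢j = contradiction refl i≢j

detLength²-comm : ∀ z w → detLength² w z ≡ detLength² z w
detLength²-comm (p₁ , q₁) (p₂ , q₂) = begin
  norm (p₂ ⊗ q₁ ⊖ p₁ ⊗ q₂)        ≡⟨ cong norm (solve 4 (λ p₁ q₁ p₂ q₂ → p₂ :* q₁ :- p₁ :* q₂ := :- (p₁ :* q₂ :- p₂ :* q₁)) refl p₁ q₁ p₂ q₂) ⟩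
  norm (⊝ (p₁ ⊗ q₂ ⊖ p₂ ⊗ q₁))    ≡⟨ norm-⊝ (p₁ ⊗ q₂ ⊖ p₂ ⊗ q₁) ⟩
  norm (p₁ ⊗ q₂ ⊖ p₂ ⊗ q₁)        ∎
  where open ≡-Reasoning; open 𝔼S

IsUnit⇒conj-⊗-self≡𝟙 : ∀ e → IsUnit e → conj e ⊗ e ≡ 𝟙
IsUnit⇒conj-⊗-self≡𝟙 e e-unit = trans (conj-⊗-self e) (cong fromℤ e-unit)

Primitive : Frac → Set
Primitive w = ∀ {z} → w ∼ z → Multiple w z

unimodular⇒primitive : ∀ w w′ → detLength² w w′ ≡ + 1 → Primitive w
unimodular⇒primitive (p′ , q′) (p₂ , q₂) unimodular {p , q} w∼z = k , cong₂ _,_ (sym k⊗p′≡p) (sym k⊗q′≡q)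
  where
  open ≡-Reasoning; open 𝔼S
  e = p′ ⊗ q₂ ⊖ p₂ ⊗ q′
  k = conj e ⊗ (p ⊗ q₂ ⊖ p₂ ⊗ q)
  ē⊗e≡𝟙 : conj e ⊗ e ≡ 𝟙
  ē⊗e≡𝟙 = IsUnit⇒conj-⊗-self≡𝟙 e unimodular
  k⊗p′≡p : k ⊗ p′ ≡ p
  k⊗p′≡p = begin
    k ⊗ p′
      ≡⟨ solve 6 (λ ē p q₂ p′ p₂ q → ē :* (p :* q₂ :- p₂ :* q) :* p′ := ē :* (p :* q₂ :* p′ :- p₂ :* (p′ :* q))) refl (conj e) p q₂ p′ p₂ q ⟩
    conj e ⊗ (p ⊗ q₂ ⊗ p′ ⊖ p₂ ⊗ (p′ ⊗ q))
      ≡⟨ cong (λ t → conj e ⊗ (p ⊗ q₂ ⊗ p′ ⊖ p₂ ⊗ t)) w∼z ⟩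
    conj e ⊗ (p ⊗ q₂ ⊗ p′ ⊖ p₂ ⊗ (p ⊗ q′))
      ≡⟨ solve 6 (λ ē p q₂ p′ p₂ q′ → ē :* (p :* q₂ :* p′ :- p₂ :* (p :* q′)) := p :* (ē :* (p′ :* q₂ :- p₂ :* q′))) refl (conj e) p q₂ p′ p₂ q′ ⟩
    p ⊗ (conj e ⊗ e)
      ≡⟨ cong (p ⊗_) ē⊗e≡𝟙 ⟩
    p ⊗ 𝟙
      ≡⟨ ⊗-identityʳ p ⟩
    p ∎
  k⊗q′≡q : k ⊗ q′ ≡ q
  k⊗q′≡q = begin
    k ⊗ q′
      ≡⟨ solve 6 (λ ē p q₂ q′ p₂ q → ē :* (p :* q₂ :- p₂ :* q) :* q′ := ē :* (q₂ :* (p :* q′) :- p₂ :* q :* q′)) refl (conj e) p q₂ q′ p₂ q ⟩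
    conj e ⊗ (q₂ ⊗ (p ⊗ q′) ⊖ p₂ ⊗ q ⊗ q′)
      ≡⟨ cong (λ t → conj e ⊗ (q₂ ⊗ t ⊖ p₂ ⊗ q ⊗ q′)) w∼z ⟨
    conj e ⊗ (q₂ ⊗ (p′ ⊗ q) ⊖ p₂ ⊗ q ⊗ q′)
      ≡⟨ solve 6 (λ ē q q₂ p′ p₂ q′ → ē :* (q₂ :* (p′ :* q) :- p₂ :* q :* q′) := q :* (ē :* (p′ :* q₂ :- p₂ :* q′))) refl (conj e) q q₂ p′ p₂ q′ ⟩
    q ⊗ (conj e ⊗ e)
      ≡⟨ cong (q ⊗_) ē⊗e≡𝟙 ⟩
    q ⊗ 𝟙
      ≡⟨ ⊗-identityʳ q ⟩
    q ∎

detLength²-· : ∀ k₁ k₂ z w → detLength² (k₁ · z) (k₂ · w) ≡ norm k₁ ℤ.* norm k₂ ℤ.* detLength² z w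
detLength²-· k₁ k₂ (p₁ , q₁) (p₂ , q₂) = begin
  norm (k₁ ⊗ p₁ ⊗ (k₂ ⊗ q₂) ⊖ k₂ ⊗ p₂ ⊗ (k₁ ⊗ q₁))
    ≡⟨ cong norm (solve 6 (λ k₁ k₂ p₁ q₁ p₂ q₂ → k₁ :* p₁ :* (k₂ :* q₂) :- k₂ :* p₂ :* (k₁ :* q₁)
                                              := k₁ :* k₂ :* (p₁ :* q₂ :- p₂ :* q₁))
                        refl k₁ k₂ p₁ q₁ p₂ q₂) ⟩
  norm (k₁ ⊗ k₂ ⊗ (p₁ ⊗ q₂ ⊖ p₂ ⊗ q₁))
    ≡⟨ norm-⊗ (k₁ ⊗ k₂) (p₁ ⊗ q₂ ⊖ p₂ ⊗ q₁) ⟩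
  norm (k₁ ⊗ k₂) ℤ.* norm (p₁ ⊗ q₂ ⊖ p₂ ⊗ q₁)
    ≡⟨ cong (ℤ._* norm (p₁ ⊗ q₂ ⊖ p₂ ⊗ q₁)) (norm-⊗ k₁ k₂) ⟩
  norm k₁ ℤ.* norm k₂ ℤ.* norm (p₁ ⊗ q₂ ⊖ p₂ ⊗ q₁) ∎
  where open ≡-Reasoning; open 𝔼S

det-·ˡ : ∀ k z w → det (k · z) w ≡ k ⊗ det z w
det-·ˡ k (p₁ , q₁) (p₂ , q₂) = solve 5 (λ k p₁ q₁ p₂ q₂ → k :* p₁ :* q₂ :- p₂ :* (k :* q₁) := k :* (p₁ :* q₂ :- p₂ :* q₁)) refl k p₁ q₁ p₂ q₂
  where open 𝔼S

irreducible-·⇒IsUnit : ∀ k w → Irreducible (k · w) → IsUnit k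
irreducible-·⇒IsUnit k w (_ , irr) = irr k (proj₁ w) (proj₂ w) refl refl

irreducible-multiples-unimodular : ∀ {w₁ w₂ z₁ z₂} → detLength² w₁ w₂ ≡ + 1 →
  Irreducible z₁ → Irreducible z₂ → Multiple w₁ z₁ → Multiple w₂ z₂ → detLength² z₁ z₂ ≡ + 1
irreducible-multiples-unimodular {w₁} {w₂} unimodular irr₁ irr₂ (k₁ , refl) (k₂ , refl) = begin
  detLength² (k₁ · w₁) (k₂ · w₂)             ≡⟨ detLength²-· k₁ k₂ w₁ w₂ ⟩
  norm k₁ ℤ.* norm k₂ ℤ.* detLength² w₁ w₂   ≡⟨ cong₂ (λ a b → a ℤ.* b ℤ.* detLength² w₁ w₂) k₁-unit k₂-unit ⟩
  + 1 ℤ.* detLength² w₁ w₂                   ≡⟨ ℤ.*-identityˡ (detLength² w₁ w₂) ⟩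
  detLength² w₁ w₂                           ≡⟨ unimodular ⟩
  + 1                                        ∎
  where
  open ≡-Reasoning
  k₁-unit = irreducible-·⇒IsUnit k₁ w₁ irr₁
  k₂-unit = irreducible-·⇒IsUnit k₂ w₂ irr₂

fundamentalEdge⇒unimodular : ∀ z₁ z₂ → Irreducible z₁ → Irreducible z₂ →
  IsFundamentalEdge z₁ z₂ → detLength² z₁ z₂ ≡ + 1
fundamentalEdge⇒unimodular z₁ z₂ irr₁ irr₂ (h , i , j , i≢j , w₁∼z₁ , w₂∼z₂) =
  irreducible-multiples-unimodular w-unimodular irr₁ irr₂
    (unimodular⇒primitive w₁ w₂ w-unimodular w₁∼z₁)
    (unimodular⇒primitive w₂ w₁ (trans (detLength²-comm w₁ w₂) w-unimodular) w₂∼z₂)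
  where
  w₁ = act h (vertT i)
  w₂ = act h (vertT j)
  w-unimodular : detLength² w₁ w₂ ≡ + 1
  w-unimodular = trans (detLength²-act h (vertT i) (vertT j)) (vertT-unimodular i j i≢j)

-- Unimodular pairs are edges of fundamental tetrahedra

-- z = p/q sits at (p q̄)/|q|², so p q̄ = a + bσ gives z the coordinates (a, b)/|q|².
scaled : Frac → 𝔼
scaled (p , q) = p ⊗ conj q

-- side k z ≥ 0 says that z lies on the same side of the vertical face k of T as T.
side : Fin 3 → Frac → ℤ
side zero             z       = co (scaled z)
side (suc zero)       z       = re (scaled z)
side (suc (suc zero)) (p , q) = norm q ℤ.- re (scaled (p , q)) ℤ.- co (scaled (p , q))

-- 9 |q|² |z − c|², where c = (1 + σ)/3 is the centre of the face (0, 1, σ).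
centroidDist : Frac → ℤ
centroidDist (p , q) = norm ((+ 3) + (+ 0) σ ⊗ p ⊖ (+ 1) + (+ 1) σ ⊗ q)

-- τ b is a symmetry of T, not in H, exchanging the vertices b and ∞ and fixing the
-- other two.
τ : Fin 4 → Frac → Frac
τ zero             = antiMob 𝟘 𝟙 𝟙 𝟘
τ (suc zero)       = antiMob 𝟙 𝟘 𝟙 (⊝ 𝟙)
τ (suc (suc zero)) = antiMob σ' 𝟘 𝟙 ((-[1+ 0 ]) + (+ 1) σ)
τ ∞                = λ z → z

-- The face of T through the vertex b that τ b carries to the vertical face k.
faceThrough : Fin 4 → Fin 3 → Fin 4
faceThrough zero             zero             = zero
faceThrough zero             (suc zero)       = suc zero
faceThrough zero             (suc (suc zero)) = hemisphere
faceThrough (suc zero)       zero             = zero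
faceThrough (suc zero)       (suc zero)       = hemisphere
faceThrough (suc zero)       (suc (suc zero)) = suc (suc zero)
faceThrough (suc (suc zero)) zero             = hemisphere
faceThrough (suc (suc zero)) (suc zero)       = suc zero
faceThrough (suc (suc zero)) (suc (suc zero)) = suc (suc zero)
faceThrough ∞                zero             = zero
faceThrough ∞                (suc zero)       = suc zero
faceThrough ∞                (suc (suc zero)) = suc (suc zero)

module SymbolicGeometry where
  open ℤS using (Polynomial; con; _:+_; _:*_; _:-_; :-_; _:=_)

  Fracˢ : Set
  Fracˢ = 𝔼ˢ {4} × 𝔼ˢ {4}

  constˢ : 𝔼 → 𝔼ˢ {4}
  constˢ x = ιˢ (re x) (co x)

  antiMobˢ : 𝔼ˢ {4} → 𝔼ˢ → 𝔼ˢ → 𝔼ˢ → Fracˢ → Fracˢ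
  antiMobˢ A B C D (p , q) = A ⊗ˢ conjˢ p ⊕ˢ B ⊗ˢ conjˢ q , C ⊗ˢ conjˢ p ⊕ˢ D ⊗ˢ conjˢ q

  reflectˢ : Fin 4 → Fracˢ → Fracˢ
  reflectˢ r = antiMobˢ (constˢ A) (constˢ B) (constˢ C) (constˢ D)
    where open IsAntiMöbiusInvolution (reflect-isAntiMöbiusInvolution r)

  scaledˢ : Fracˢ → 𝔼ˢ {4}
  scaledˢ (p , q) = p ⊗ˢ conjˢ q

  sideˢ : Fin 3 → Fracˢ → Polynomial 4
  sideˢ zero             z       = proj₂ (scaledˢ z)
  sideˢ (suc zero)       z       = proj₁ (scaledˢ z)
  sideˢ (suc (suc zero)) (p , q) = normˢ q :- proj₁ (scaledˢ (p , q)) :- proj₂ (scaledˢ (p , q))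

  centroidDistˢ : Fracˢ → Polynomial 4
  centroidDistˢ (p , q) = normˢ (ιˢ (+ 3) (+ 0) ⊗ˢ p ⊖ˢ ιˢ (+ 1) (+ 1) ⊗ˢ q)

  τˢ : Fin 4 → Fracˢ → Fracˢ
  τˢ zero             = antiMobˢ (constˢ 𝟘) (constˢ 𝟙) (constˢ 𝟙) (constˢ 𝟘)
  τˢ (suc zero)       = antiMobˢ (constˢ 𝟙) (constˢ 𝟘) (constˢ 𝟙) (constˢ (⊝ 𝟙))
  τˢ (suc (suc zero)) = antiMobˢ (constˢ σ') (constˢ 𝟘) (constˢ 𝟙) (ιˢ (-[1+ 0 ]) (+ 1))
  τˢ ∞                = λ z → z

  denominatorEquation : Fin 4 → (a b c d : Polynomial 4) → Polynomial 4 × Polynomial 4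
  denominatorEquation b a₁ a₂ a₃ a₄ =
    normˢ (proj₂ (τˢ b ((a₁ , a₂) , (a₃ , a₄)))) := normˢ (constˢ p ⊗ˢ (a₃ , a₄) ⊖ˢ (a₁ , a₂) ⊗ˢ constˢ q)
    where p = proj₁ (vertT b); q = proj₂ (vertT b)

  descentEquation : Fin 4 → Fin 3 → (a b c d : Polynomial 4) → Polynomial 4 × Polynomial 4
  descentEquation b k a₁ a₂ a₃ a₄ =
    centroidDistˢ (τˢ b (reflectˢ (faceThrough b k) z)) := centroidDistˢ (τˢ b z) :+ con (+ 9) :* sideˢ k (τˢ b z)
    where z = (a₁ , a₂) , (a₃ , a₄)

  verticalNormEquation : Fin 3 → (a b c d : Polynomial 4) → Polynomial 4 × Polynomial 4
  verticalNormEquation k a₁ a₂ a₃ a₄ = normˢ (proj₂ (reflectˢ (faceThrough ∞ k) z)) := normˢ (a₃ , a₄)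
    where z = (a₁ , a₂) , (a₃ , a₄)

  sphereEquation : (a b c d : Polynomial 4) → Polynomial 4 × Polynomial 4
  sphereEquation a₁ a₂ a₃ a₄ =
    normˢ (proj₂ (reflectˢ hemisphere z)) := normˢ (a₃ , a₄) :+ con (+ 3) :* (normˢ (a₁ , a₂) :- proj₁ (scaledˢ z) :- proj₂ (scaledˢ z))
    where z = (a₁ , a₂) , (a₃ , a₄)

open SymbolicGeometry

centroidDist-reflect : ∀ b k z →
  centroidDist (τ b (reflect (faceThrough b k) z)) ≡ centroidDist (τ b z) ℤ.+ + 9 ℤ.* side k (τ b z)
centroidDist-reflect zero             zero             (p , q) =
  ℤS.solve 4 (descentEquation zero zero) refl (re p) (co p) (re q) (co q)
centroidDist-reflect zero             (suc zero)       (p , q) =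
  ℤS.solve 4 (descentEquation zero (suc zero)) refl (re p) (co p) (re q) (co q)
centroidDist-reflect zero             (suc (suc zero)) (p , q) =
  ℤS.solve 4 (descentEquation zero (suc (suc zero))) refl (re p) (co p) (re q) (co q)
centroidDist-reflect (suc zero)       zero             (p , q) =
  ℤS.solve 4 (descentEquation (suc zero) zero) refl (re p) (co p) (re q) (co q)
centroidDist-reflect (suc zero)       (suc zero)       (p , q) =
  ℤS.solve 4 (descentEquation (suc zero) (suc zero)) refl (re p) (co p) (re q) (co q)
centroidDist-reflect (suc zero)       (suc (suc zero)) (p , q) =
  ℤS.solve 4 (descentEquation (suc zero) (suc (suc zero))) refl (re p) (co p) (re q) (co q)
centroidDist-reflect (suc (suc zero)) zero             (p , q) =
  ℤS.solve 4 (descentEquation (suc (suc zero)) zero) refl (re p) (co p) (re q) (co q)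
centroidDist-reflect (suc (suc zero)) (suc zero)       (p , q) =
  ℤS.solve 4 (descentEquation (suc (suc zero)) (suc zero)) refl (re p) (co p) (re q) (co q)
centroidDist-reflect (suc (suc zero)) (suc (suc zero)) (p , q) =
  ℤS.solve 4 (descentEquation (suc (suc zero)) (suc (suc zero))) refl (re p) (co p) (re q) (co q)
centroidDist-reflect ∞                zero             (p , q) =
  ℤS.solve 4 (descentEquation ∞ zero) refl (re p) (co p) (re q) (co q)
centroidDist-reflect ∞                (suc zero)       (p , q) =
  ℤS.solve 4 (descentEquation ∞ (suc zero)) refl (re p) (co p) (re q) (co q)
centroidDist-reflect ∞                (suc (suc zero)) (p , q) =
  ℤS.solve 4 (descentEquation ∞ (suc (suc zero))) refl (re p) (co p) (re q) (co q)

norm-denominator-reflect-vertical : ∀ k z →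
  norm (proj₂ (reflect (faceThrough ∞ k) z)) ≡ norm (proj₂ z)
norm-denominator-reflect-vertical zero             (p , q) =
  ℤS.solve 4 (verticalNormEquation zero) refl (re p) (co p) (re q) (co q)
norm-denominator-reflect-vertical (suc zero)       (p , q) =
  ℤS.solve 4 (verticalNormEquation (suc zero)) refl (re p) (co p) (re q) (co q)
norm-denominator-reflect-vertical (suc (suc zero)) (p , q) =
  ℤS.solve 4 (verticalNormEquation (suc (suc zero))) refl (re p) (co p) (re q) (co q)

norm-denominator-reflect-sphere : ∀ z →
  norm (proj₂ (reflect hemisphere z))
    ≡ norm (proj₂ z) ℤ.+ + 3 ℤ.* (norm (proj₁ z) ℤ.- re (scaled z) ℤ.- co (scaled z))
norm-denominator-reflect-sphere (p , q) = ℤS.solve 4 sphereEquation refl (re p) (co p) (re q) (co q)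

-- τ b carries the vertex b to ∞, so it turns det-lengths to b into norms of denominators.
norm-denominator-τ : ∀ b z → norm (proj₂ (τ b z)) ≡ detLength² (vertT b) z
norm-denominator-τ zero             (p , q) = ℤS.solve 4 (denominatorEquation zero) refl (re p) (co p) (re q) (co q)
norm-denominator-τ (suc zero)       (p , q) = ℤS.solve 4 (denominatorEquation (suc zero)) refl (re p) (co p) (re q) (co q)
norm-denominator-τ (suc (suc zero)) (p , q) = ℤS.solve 4 (denominatorEquation (suc (suc zero))) refl (re p) (co p) (re q) (co q)
norm-denominator-τ ∞                (p , q) = ℤS.solve 4 (denominatorEquation ∞) refl (re p) (co p) (re q) (co q)

τ-isAntiMöbiusInvolution : ∀ (b : Fin 3) → IsAntiMöbiusInvolution (τ (inject₁ b))
τ-isAntiMöbiusInvolution zero = record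
  { A = 𝟘 ; B = 𝟙 ; C = 𝟙 ; D = 𝟘
  ; f≗antiMob = λ _ → refl ; det-isUnit = refl ; M·M̄≡I = refl }
τ-isAntiMöbiusInvolution (suc zero) = record
  { A = 𝟙 ; B = 𝟘 ; C = 𝟙 ; D = ⊝ 𝟙
  ; f≗antiMob = λ _ → refl ; det-isUnit = refl ; M·M̄≡I = refl }
τ-isAntiMöbiusInvolution (suc (suc zero)) = record
  { A = σ' ; B = 𝟘 ; C = 𝟙 ; D = (-[1+ 0 ]) + (+ 1) σ
  ; f≗antiMob = λ _ → refl ; det-isUnit = refl ; M·M̄≡I = refl }

τ-involutive : ∀ b z → τ b (τ b z) ≡ z
τ-involutive zero             = AntiMöbiusInvolution.involutive (τ-isAntiMöbiusInvolution zero)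
τ-involutive (suc zero)       = AntiMöbiusInvolution.involutive (τ-isAntiMöbiusInvolution (suc zero))
τ-involutive (suc (suc zero)) = AntiMöbiusInvolution.involutive (τ-isAntiMöbiusInvolution (suc (suc zero)))
τ-involutive ∞                = λ _ → refl

τ-Multiple : ∀ b {w z} → Multiple w z → Multiple (τ b w) (τ b z)
τ-Multiple zero             = AntiMöbiusInvolution.preserves-Multiple (τ-isAntiMöbiusInvolution zero)
τ-Multiple (suc zero)       = AntiMöbiusInvolution.preserves-Multiple (τ-isAntiMöbiusInvolution (suc zero))
τ-Multiple (suc (suc zero)) = AntiMöbiusInvolution.preserves-Multiple (τ-isAntiMöbiusInvolution (suc (suc zero)))
τ-Multiple ∞                = λ m → m

Corner : ℕ → ℕ → ℕ → Set
Corner N A B = (A ≡ 0 × B ≡ 0) ⊎ (A ≡ N × B ≡ 0) ⊎ (A ≡ 0 × B ≡ N)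

-- (A + B)² ≤ M N = A² + AB + B² forces AB = 0.
triangle-corner : ∀ A B N M → A ℕ.+ B ℕ.≤ N → A ℕ.+ B ℕ.≤ M →
  A ℕ.* A ℕ.+ A ℕ.* B ℕ.+ B ℕ.* B ≡ M ℕ.* N → Corner N A B
triangle-corner A B N M A+B≤N A+B≤M norm≡MN = corner (ℕ.m*n≡0⇒m≡0∨n≡0 A A*B≡0)
  where
  open ℕS
  A*B≡0 : A ℕ.* B ≡ 0
  A*B≡0 = ℕ.n≤0⇒n≡0 (ℕ.+-cancelˡ-≤ (A ℕ.* A ℕ.+ A ℕ.* B ℕ.+ B ℕ.* B) (A ℕ.* B) 0 (begin
    A ℕ.* A ℕ.+ A ℕ.* B ℕ.+ B ℕ.* B ℕ.+ A ℕ.* B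
      ≡⟨ solve 2 (λ A B → A :* A :+ A :* B :+ B :* B :+ A :* B := (A :+ B) :* (A :+ B)) refl A B ⟩
    (A ℕ.+ B) ℕ.* (A ℕ.+ B)           ≤⟨ ℕ.*-mono-≤ A+B≤M A+B≤N ⟩
    M ℕ.* N                           ≡⟨ norm≡MN ⟨
    A ℕ.* A ℕ.+ A ℕ.* B ℕ.+ B ℕ.* B     ≡⟨ ℕ.+-identityʳ _ ⟨
    A ℕ.* A ℕ.+ A ℕ.* B ℕ.+ B ℕ.* B ℕ.+ 0 ∎))
    where open ℕ.≤-Reasoning
  A²+A0+0≡A² : A ℕ.* A ℕ.+ A ℕ.* 0 ℕ.+ 0 ℕ.* 0 ≡ A ℕ.* A
  A²+A0+0≡A² = solve 1 (λ A → A :* A :+ A :* con 0 :+ con 0 :* con 0 := A :* A) refl A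
  0-or-N : ∀ C → C ℕ.≤ N → C ℕ.* N ℕ.≤ C ℕ.* C → C ≡ 0 ⊎ C ≡ N
  0-or-N zero    _   _     = inj₁ refl
  0-or-N (suc C) C≤N CN≤CC = inj₂ (ℕ.≤-antisym C≤N (ℕ.*-cancelˡ-≤ (suc C) CN≤CC))
  corner : A ≡ 0 ⊎ B ≡ 0 → Corner N A B
  corner (inj₁ refl) with 0-or-N B A+B≤N (ℕ.≤-trans (ℕ.*-monoˡ-≤ N A+B≤M) (ℕ.≤-reflexive (sym norm≡MN)))
  ... | inj₁ refl = inj₁ (refl , refl)
  ... | inj₂ B≡N  = inj₂ (inj₂ (refl , B≡N))
  corner (inj₂ refl) with 0-or-N A (ℕ.≤-trans (ℕ.m≤m+n A 0) A+B≤N)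
    (ℕ.≤-trans (ℕ.*-monoˡ-≤ N (ℕ.≤-trans (ℕ.m≤m+n A 0) A+B≤M)) (ℕ.≤-reflexive (trans (sym norm≡MN) A²+A0+0≡A²)))
  ... | inj₁ refl = inj₁ (refl , refl)
  ... | inj₂ A≡N  = inj₂ (inj₁ (A≡N , refl))

unit-triangle-corner : ∀ A B → A ℕ.+ B ℕ.≤ 1 → Corner 1 A B
unit-triangle-corner 0             0             _             = inj₁ (refl , refl)
unit-triangle-corner 1             0             _             = inj₂ (inj₁ (refl , refl))
unit-triangle-corner 0             1             _             = inj₂ (inj₂ (refl , refl))
unit-triangle-corner 1             (suc B)       (ℕ.s≤s ())
unit-triangle-corner (suc (suc A)) B             (ℕ.s≤s ())
unit-triangle-corner 0             (suc (suc B)) (ℕ.s≤s ())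

module _ {S G : Set} (move : G → S → S) {ℓ} {_≺_ : Rel S ℓ} (≺-wellFounded : WellFounded _≺_)
         (Inv Goal : S → Set) where

  descend : (∀ s → Inv s → Goal s ⊎ Σ G λ g → Inv (move g s) × move g s ≺ s) →
            ∀ s → Inv s → Σ (List G) λ w → Goal (foldr move s w)
  descend step s inv = go s inv (≺-wellFounded s)
    where
    go : ∀ s → Inv s → Acc _≺_ s → Σ (List G) λ w → Goal (foldr move s w)
    go s inv (acc rec) with step s inv
    ... | inj₁ goal = [] , goal
    ... | inj₂ (g , inv′ , g·s≺s) with go (move g s) inv′ (rec g·s≺s)
    ...   | w , goal = w ∷ʳ g , subst Goal (sym (foldr-∷ʳ move s g w)) goal

nonNeg-<⇒∣∣< : ∀ {x y} → 0ℤ ℤ.≤ x → x ℤ.< y → ∣ x ∣ ℕ.< ∣ y ∣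
nonNeg-<⇒∣∣< (ℤ.+≤+ _) (ℤ.+<+ m<n) = m<n

∣∣-shrink : ∀ x c {y} .{{_ : ℤ.Positive c}} → 0ℤ ℤ.≤ x ℤ.+ c ℤ.* y → y ℤ.< 0ℤ → ∣ x ℤ.+ c ℤ.* y ∣ ℕ.< ∣ x ∣
∣∣-shrink x c {y} 0≤x+cy y<0 = nonNeg-<⇒∣∣< 0≤x+cy (begin-strict
  x ℤ.+ c ℤ.* y    <⟨ ℤ.+-monoʳ-< x (subst (c ℤ.* y ℤ.<_) (ℤ.*-zeroʳ c) (ℤ.*-monoˡ-<-pos c y<0)) ⟩
  x ℤ.+ 0ℤ         ≡⟨ ℤ.+-identityʳ x ⟩
  x                ∎)
  where open ℤ.≤-Reasoning

AtVertex : Fin 4 → Frac → Set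
AtVertex i = Multiple (vertT i)

vertT-primitive : ∀ i → Primitive (vertT i)
vertT-primitive zero             = unimodular⇒primitive (vertT zero) (vertT ∞) refl
vertT-primitive (suc zero)       = unimodular⇒primitive (vertT (suc zero)) (vertT ∞) refl
vertT-primitive (suc (suc zero)) = unimodular⇒primitive (vertT (suc (suc zero))) (vertT ∞) refl
vertT-primitive ∞                = unimodular⇒primitive (vertT ∞) (vertT zero) refl

AtVertex∞ : ∀ {p q} → q ≡ 𝟘 → AtVertex ∞ (p , q)
AtVertex∞ {p} refl = p , cong₂ _,_ (sym (⊗-identityʳ p)) (sym (solve 1 (λ p → p :* con 𝟘 := con 𝟘) refl p))
  where open 𝔼S

multiple-of-finite : ∀ v {p q} → p ≡ v ⊗ q → Multiple (v , 𝟙) (p , q)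
multiple-of-finite v {p} {q} p≡v⊗q = q , cong₂ _,_ (trans p≡v⊗q (⊗-comm v q)) (sym (⊗-identityʳ q))

AtVertex-finite : ∀ k {p q} → p ≡ proj₁ (vertT (inject₁ k)) ⊗ q → AtVertex (inject₁ k) (p , q)
AtVertex-finite zero             = multiple-of-finite 𝟘
AtVertex-finite (suc zero)       = multiple-of-finite 𝟙
AtVertex-finite (suc (suc zero)) = multiple-of-finite σ'

faceThrough-fixes : ∀ b k → vertT b ∼ reflect (faceThrough b k) (vertT b)
faceThrough-fixes zero             zero             = refl
faceThrough-fixes zero             (suc zero)       = refl
faceThrough-fixes zero             (suc (suc zero)) = refl
faceThrough-fixes (suc zero)       zero             = refl
faceThrough-fixes (suc zero)       (suc zero)       = refl
faceThrough-fixes (suc zero)       (suc (suc zero)) = refl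
faceThrough-fixes (suc (suc zero)) zero             = refl
faceThrough-fixes (suc (suc zero)) (suc zero)       = refl
faceThrough-fixes (suc (suc zero)) (suc (suc zero)) = refl
faceThrough-fixes ∞                zero             = refl
faceThrough-fixes ∞                (suc zero)       = refl
faceThrough-fixes ∞                (suc (suc zero)) = refl

AtVertex-reflect : ∀ b k {z} → AtVertex b z → AtVertex b (reflect (faceThrough b k) z)
AtVertex-reflect b k z-at-b = Multiple-trans (vertT-primitive b (faceThrough-fixes b k))
  (Reflect.preserves-Multiple (faceThrough b k) z-at-b)

τ-vertT : ∀ b (i : Fin 3) → Σ (Fin 4) λ j → j ≢ b × vertT j ∼ τ b (vertT (inject₁ i))
τ-vertT zero             zero             = ∞ , (λ ()) , refl
τ-vertT zero             (suc zero)       = suc zero , (λ ()) , refl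
τ-vertT zero             (suc (suc zero)) = suc (suc zero) , (λ ()) , refl
τ-vertT (suc zero)       zero             = zero , (λ ()) , refl
τ-vertT (suc zero)       (suc zero)       = ∞ , (λ ()) , refl
τ-vertT (suc zero)       (suc (suc zero)) = suc (suc zero) , (λ ()) , refl
τ-vertT (suc (suc zero)) zero             = zero , (λ ()) , refl
τ-vertT (suc (suc zero)) (suc zero)       = suc zero , (λ ()) , refl
τ-vertT (suc (suc zero)) (suc (suc zero)) = ∞ , (λ ()) , refl
τ-vertT ∞                zero             = zero , (λ ()) , refl
τ-vertT ∞                (suc zero)       = suc zero , (λ ()) , refl
τ-vertT ∞                (suc (suc zero)) = suc (suc zero) , (λ ()) , refl

AtVertex-τ : ∀ b i {z} → AtVertex (inject₁ i) (τ b z) → Σ (Fin 4) λ j → j ≢ b × AtVertex j z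
AtVertex-τ b i {z} τz-at-i = j , j≢b , Multiple-trans (vertT-primitive j vj∼τvi)
  (subst (Multiple (τ b (vertT (inject₁ i)))) (τ-involutive b z) (τ-Multiple b τz-at-i))
  where
  j = proj₁ (τ-vertT b i)
  j≢b = proj₁ (proj₂ (τ-vertT b i))
  vj∼τvi = proj₂ (proj₂ (τ-vertT b i))

AtVertex-unimodular⇒unit-denominator : ∀ b {z₁ z₂} → AtVertex b z₁ → detLength² z₁ z₂ ≡ + 1 → IsUnit (proj₂ (τ b z₂))
AtVertex-unimodular⇒unit-denominator b {z₂ = z₂} (c , refl) unimodular =
  trans (norm-denominator-τ b z₂)
    (IsUnit-⊗⇒IsUnitʳ c (det (vertT b) z₂) (trans (cong norm (sym (det-·ˡ c (vertT b) z₂))) unimodular))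

TriangleVertex : ℤ → ℤ → ℤ → Set
TriangleVertex n a b = Σ (Fin 3) λ k → a + b σ ≡ fromℤ n ⊗ proj₁ (vertT (inject₁ k))

corner⇒TriangleVertex : ∀ {N A B} → Corner N A B → TriangleVertex (+ N) (+ A) (+ B)
corner⇒TriangleVertex {N} (inj₁ (refl , refl)) =
  zero , sym (solve 1 (λ n → n :* con 𝟘 := con 𝟘) refl (fromℤ (+ N)))
  where open 𝔼S
corner⇒TriangleVertex {N} (inj₂ (inj₁ (refl , refl))) =
  suc zero , sym (⊗-identityʳ (fromℤ (+ N)))
corner⇒TriangleVertex {N} (inj₂ (inj₂ (refl , refl))) = suc (suc zero) , 𝔼-≡
  (solve 1 (λ n → con (+ 0) := n :* con (+ 0) :- con (+ 0) :* con (+ 1)) refl (+ N))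
  (solve 1 (λ n → n := n :* con (+ 1) :+ con (+ 0) :* con (+ 0) :+ con (+ 0) :* con (+ 1)) refl (+ N))
  where open ℤS

ℤ-triangle-vertex : ∀ {a b n m} → 0ℤ ℤ.≤ a → 0ℤ ℤ.≤ b → 0ℤ ℤ.≤ n → 0ℤ ℤ.≤ m →
  0ℤ ℤ.≤ n ℤ.- a ℤ.- b → a ℤ.+ b ℤ.≤ m → a ℤ.* a ℤ.+ a ℤ.* b ℤ.+ b ℤ.* b ≡ m ℤ.* n →
  TriangleVertex n a b
ℤ-triangle-vertex {+ A} {+ B} {+ N} {+ M} _ _ _ _ 0≤n-a-b a+b≤m norm≡mn =
  corner⇒TriangleVertex $ triangle-corner A B N M (ℤ.drop‿+≤+ a+b≤n) (ℤ.drop‿+≤+ a+b≤m) (ℤ.+-injective (begin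
    + (A ℕ.* A ℕ.+ A ℕ.* B ℕ.+ B ℕ.* B)                    ≡⟨ ℤ.pos-+ (A ℕ.* A ℕ.+ A ℕ.* B) (B ℕ.* B) ⟩
    + (A ℕ.* A ℕ.+ A ℕ.* B) ℤ.+ + (B ℕ.* B)                ≡⟨ cong₂ ℤ._+_ (ℤ.pos-+ (A ℕ.* A) (A ℕ.* B)) (ℤ.pos-* B B) ⟩
    + (A ℕ.* A) ℤ.+ + (A ℕ.* B) ℤ.+ + B ℤ.* + B            ≡⟨ cong₂ (λ x y → x ℤ.+ y ℤ.+ + B ℤ.* + B) (ℤ.pos-* A A) (ℤ.pos-* A B) ⟩
    + A ℤ.* + A ℤ.+ + A ℤ.* + B ℤ.+ + B ℤ.* + B            ≡⟨ norm≡mn ⟩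
    + M ℤ.* + N                                            ≡⟨ ℤ.pos-* M N ⟨
    + (M ℕ.* N)                                            ∎))
  where
  open ≡-Reasoning
  a+b≤n : + A ℤ.+ + B ℤ.≤ + N
  a+b≤n = ℤ.0≤i-j⇒j≤i (subst (0ℤ ℤ.≤_) (solve 3 (λ n a b → n :- a :- b := n :- (a :+ b)) refl (+ N) (+ A) (+ B)) 0≤n-a-b)
    where open ℤS

ℤ-unit-triangle-vertex : ∀ {a b} → 0ℤ ℤ.≤ a → 0ℤ ℤ.≤ b → 0ℤ ℤ.≤ + 1 ℤ.- a ℤ.- b → TriangleVertex (+ 1) a b
ℤ-unit-triangle-vertex {+ A} {+ B} _ _ 0≤1-a-b = corner⇒TriangleVertex $ unit-triangle-corner A B (ℤ.drop‿+≤+ (ℤ.0≤i-j⇒j≤i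
  (subst (0ℤ ℤ.≤_) (solve 2 (λ a b → con (+ 1) :- a :- b := con (+ 1) :- (a :+ b)) refl (+ A) (+ B)) 0≤1-a-b)))
  where open ℤS

fromℤ-norm-⊗ : ∀ p q → fromℤ (norm q) ⊗ p ≡ scaled (p , q) ⊗ q
fromℤ-norm-⊗ p q = begin
  fromℤ (norm q) ⊗ p    ≡⟨ cong (_⊗ p) (conj-⊗-self q) ⟨
  conj q ⊗ q ⊗ p        ≡⟨ solve 3 (λ q̄ q p → q̄ :* q :* p := p :* q̄ :* q) refl (conj q) q p ⟩
  p ⊗ conj q ⊗ q        ∎
  where open ≡-Reasoning; open 𝔼S

scaled-vertex⇒AtVertex : ∀ {p q} k → q ≢ 𝟘 →
  scaled (p , q) ≡ fromℤ (norm q) ⊗ proj₁ (vertT (inject₁ k)) → AtVertex (inject₁ k) (p , q)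
scaled-vertex⇒AtVertex {p} {q} k q≢𝟘 scaled≡ = AtVertex-finite k (⊗-cancelˡ Nq≢𝟘 (begin
  fromℤ (norm q) ⊗ p         ≡⟨ fromℤ-norm-⊗ p q ⟩
  scaled (p , q) ⊗ q         ≡⟨ cong (_⊗ q) scaled≡ ⟩
  fromℤ (norm q) ⊗ v ⊗ q     ≡⟨ ⊗-assoc (fromℤ (norm q)) v q ⟩
  fromℤ (norm q) ⊗ (v ⊗ q)   ∎))
  where
  open ≡-Reasoning
  v = proj₁ (vertT (inject₁ k))
  Nq≢𝟘 : fromℤ (norm q) ≢ 𝟘
  Nq≢𝟘 eq = q≢𝟘 (norm≡0⇒≡𝟘 q (cong re eq))

norm-scaled : ∀ p q → norm (scaled (p , q)) ≡ norm p ℤ.* norm q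
norm-scaled p q = trans (norm-⊗ p (conj q)) (cong (norm p ℤ.*_) (norm-conj q))

OverT : Frac → Set
OverT z = ∀ k → 0ℤ ℤ.≤ side k z

-- re (scaled z) + co (scaled z) ≤ norm p says that z is not inside the circle through 0, 1, σ.
overT-outside⇒AtVertex : ∀ {p q} → q ≢ 𝟘 → OverT (p , q) → re (scaled (p , q)) ℤ.+ co (scaled (p , q)) ℤ.≤ norm p →
  Σ (Fin 3) λ k → AtVertex (inject₁ k) (p , q)
overT-outside⇒AtVertex {p} {q} q≢𝟘 overT outside = k , scaled-vertex⇒AtVertex k q≢𝟘 scaled≡
  where
  vertex : TriangleVertex (norm q) (re (scaled (p , q))) (co (scaled (p , q)))
  vertex = ℤ-triangle-vertex (overT (suc zero)) (overT zero) (norm-nonNeg q) (norm-nonNeg p)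
             (overT (suc (suc zero))) outside (norm-scaled p q)
  k = proj₁ vertex
  scaled≡ = proj₂ vertex

overT-unit⇒AtVertex : ∀ {p q} → IsUnit q → OverT (p , q) → Σ (Fin 3) λ k → AtVertex (inject₁ k) (p , q)
overT-unit⇒AtVertex {p} {q} q-unit overT = k , scaled-vertex⇒AtVertex k q≢𝟘 scaled≡
  where
  a = re (scaled (p , q))
  b = co (scaled (p , q))
  vertex : TriangleVertex (+ 1) a b
  vertex = ℤ-unit-triangle-vertex (overT (suc zero)) (overT zero)
             (subst (λ n → 0ℤ ℤ.≤ n ℤ.- a ℤ.- b) q-unit (overT (suc (suc zero))))
  k = proj₁ vertex
  scaled≡ : scaled (p , q) ≡ fromℤ (norm q) ⊗ proj₁ (vertT (inject₁ k))
  scaled≡ = subst (λ n → a + b σ ≡ fromℤ n ⊗ proj₁ (vertT (inject₁ k))) (sym q-unit) (proj₂ vertex)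
  q≢𝟘 : q ≢ 𝟘
  q≢𝟘 refl = contradiction q-unit λ ()

overT? : ∀ z → OverT z ⊎ Σ (Fin 3) λ k → side k z ℤ.< 0ℤ
overT? z with all? (λ k → 0ℤ ℤ.≤? side k z)
... | yes overT = inj₁ overT
... | no ¬overT = inj₂ (k , ℤ.≰⇒> 0≰side)
  where
  k,0≰side = ¬∀⟶∃¬ 3 _ (λ k → 0ℤ ℤ.≤? side k z) ¬overT
  k = proj₁ k,0≰side
  0≰side = proj₂ k,0≰side

centroidDist-nonNeg : ∀ z → 0ℤ ℤ.≤ centroidDist z
centroidDist-nonNeg (p , q) = norm-nonNeg ((+ 3) + (+ 0) σ ⊗ p ⊖ (+ 1) + (+ 1) σ ⊗ q)

centroidDist-decreases : ∀ b k z → side k (τ b z) ℤ.< 0ℤ →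
  ∣ centroidDist (τ b (reflect (faceThrough b k) z)) ∣ ℕ.< ∣ centroidDist (τ b z) ∣
centroidDist-decreases b k z side<0 = subst (λ d → ∣ d ∣ ℕ.< ∣ centroidDist (τ b z) ∣) (sym (centroidDist-reflect b k z))
  (∣∣-shrink (centroidDist (τ b z)) (+ 9)
    (subst (0ℤ ℤ.≤_) (centroidDist-reflect b k z) (centroidDist-nonNeg (τ b (reflect (faceThrough b k) z)))) side<0)

norm-denominator-decreases : ∀ p q → norm p ℤ.< re (scaled (p , q)) ℤ.+ co (scaled (p , q)) →
  ∣ norm (proj₂ (reflect hemisphere (p , q))) ∣ ℕ.< ∣ norm q ∣
norm-denominator-decreases p q inside = subst (λ n → ∣ n ∣ ℕ.< ∣ norm q ∣) (sym (norm-denominator-reflect-sphere (p , q)))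
  (∣∣-shrink (norm q) (+ 3) (subst (0ℤ ℤ.≤_) (norm-denominator-reflect-sphere (p , q)) (norm-nonNeg (proj₂ (reflect hemisphere (p , q))))) (begin-strict
    norm p ℤ.- a ℤ.- b      ≡⟨ solve 3 (λ n a b → n :- a :- b := n :- (a :+ b)) refl (norm p) a b ⟩
    norm p ℤ.- (a ℤ.+ b)    <⟨ ℤ.+-monoˡ-< (ℤ.- (a ℤ.+ b)) inside ⟩
    (a ℤ.+ b) ℤ.- (a ℤ.+ b) ≡⟨ ℤ.+-inverseʳ (a ℤ.+ b) ⟩
    0ℤ                      ∎))
  where
  open ℤ.≤-Reasoning; open ℤS
  a = re (scaled (p , q))
  b = co (scaled (p , q))

height : Frac → ℕ × ℕ
height (p , q) = ∣ norm q ∣ , ∣ centroidDist (p , q) ∣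

_≺_ : Rel Frac _
_≺_ = ×-Lex _≡_ ℕ._<_ ℕ._<_ on height

≺-wellFounded : WellFounded _≺_
≺-wellFounded = On.wellFounded height (×-wellFounded <-wellFounded <-wellFounded)

AtSomeVertex : Frac → Set
AtSomeVertex z = Σ (Fin 4) λ i → AtVertex i z

ReductionStep : Frac → Set
ReductionStep z = AtSomeVertex z ⊎ Σ (Fin 4) λ r → ⊤ × reflect r z ≺ z

reduction-step : ∀ z → ⊤ → ReductionStep z
reduction-step (p , q) _ = by-denominator (q ≟ 𝟘)
  where
  a+b = re (scaled (p , q)) ℤ.+ co (scaled (p , q))
  by-circle : q ≢ 𝟘 → OverT (p , q) → Dec (norm p ℤ.< a+b) → ReductionStep (p , q)
  by-circle _   _     (yes inside)  = inj₂ (hemisphere , tt , inj₁ (norm-denominator-decreases p q inside))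
  by-circle q≢𝟘 overT (no outside) =
    let (k , at-k) = overT-outside⇒AtVertex q≢𝟘 overT (ℤ.≮⇒≥ outside) in inj₁ (inject₁ k , at-k)
  by-sides : q ≢ 𝟘 → OverT (p , q) ⊎ Σ (Fin 3) (λ k → side k (p , q) ℤ.< 0ℤ) → ReductionStep (p , q)
  by-sides q≢𝟘 (inj₁ overT)        = by-circle q≢𝟘 overT (norm p ℤ.<? a+b)
  by-sides _   (inj₂ (k , side<0)) = inj₂ (faceThrough ∞ k , tt , inj₂
    (cong ∣_∣ (norm-denominator-reflect-vertical k (p , q)) , centroidDist-decreases ∞ k (p , q) side<0))
  by-denominator : Dec (q ≡ 𝟘) → ReductionStep (p , q)
  by-denominator (yes q≡𝟘) = inj₁ (∞ , AtVertex∞ q≡𝟘)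
  by-denominator (no q≢𝟘)  = by-sides q≢𝟘 (overT? (p , q))

reduce-to-vertex : ∀ z → Σ H λ h → AtSomeVertex (act h z)
reduce-to-vertex z = descend reflect ≺-wellFounded (λ _ → ⊤) AtSomeVertex reduction-step z tt

reflect² : Fin 4 → Frac × Frac → Frac × Frac
reflect² r (z₁ , z₂) = reflect r z₁ , reflect r z₂

foldr-reflect² : ∀ h z₁ z₂ → foldr reflect² (z₁ , z₂) h ≡ (act h z₁ , act h z₂)
foldr-reflect² []      z₁ z₂ = refl
foldr-reflect² (r ∷ h) z₁ z₂ = cong (reflect² r) (foldr-reflect² h z₁ z₂)

module _ (b : Fin 4) where

  Anchored : Frac × Frac → Set
  Anchored (z₁ , z₂) = AtVertex b z₁ × detLength² z₁ z₂ ≡ + 1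

  IsVertexPair : Frac × Frac → Set
  IsVertexPair (z₁ , z₂) = AtVertex b z₁ × Σ (Fin 4) λ j → j ≢ b × AtVertex j z₂

  AnchoredStep : Frac × Frac → Set
  AnchoredStep s = IsVertexPair s ⊎ Σ (Fin 4) λ r → Anchored (reflect² r s) ×
    ∣ centroidDist (τ b (reflect r (proj₂ s))) ∣ ℕ.< ∣ centroidDist (τ b (proj₂ s)) ∣

  anchored-step : ∀ s → Anchored s → AnchoredStep s
  anchored-step (z₁ , z₂) (z₁-at-b , unimodular) = by-sides (overT? (τ b z₂))
    where
    by-sides : OverT (τ b z₂) ⊎ Σ (Fin 3) (λ k → side k (τ b z₂) ℤ.< 0ℤ) → AnchoredStep (z₁ , z₂)
    by-sides (inj₁ overT) =
      let (k , τz₂-at-k) = overT-unit⇒AtVertex (AtVertex-unimodular⇒unit-denominator b z₁-at-b unimodular) overT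
      in inj₁ (z₁-at-b , AtVertex-τ b k τz₂-at-k)
    by-sides (inj₂ (k , side<0)) = inj₂ (faceThrough b k ,
      (AtVertex-reflect b k z₁-at-b , trans (Reflect.preserves-detLength² (faceThrough b k) z₁ z₂) unimodular) ,
      centroidDist-decreases b k z₂ side<0)

  reduce-at-vertex : ∀ z₁ z₂ → Anchored (z₁ , z₂) → Σ H λ h → IsVertexPair (act h z₁ , act h z₂)
  reduce-at-vertex z₁ z₂ anchored = h , subst IsVertexPair (foldr-reflect² h z₁ z₂) pair
    where
    reduced = descend reflect² (On.wellFounded (λ s → ∣ centroidDist (τ b (proj₂ s)) ∣) <-wellFounded)
                Anchored IsVertexPair anchored-step (z₁ , z₂) anchored
    h = proj₁ reduced
    pair = proj₂ reduced

Multiple-act⇒∼ : ∀ g {w z} → Multiple w (act g z) → act (reverse g) w ∼ z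
Multiple-act⇒∼ g {w} {z} m = Multiple⇒∼ (subst (Multiple (act (reverse g) w)) (act-reverse g z) (act-Multiple (reverse g) m))

unimodular⇒fundamentalEdge : ∀ z₁ z₂ → detLength² z₁ z₂ ≡ + 1 → IsFundamentalEdge z₁ z₂
unimodular⇒fundamentalEdge z₁ z₂ unimodular =
  let h₁ , i , z₁-at-i = reduce-to-vertex z₁
      h₂ , at-i , j , j≢i , at-j = reduce-at-vertex i (act h₁ z₁) (act h₁ z₂)
                                     (z₁-at-i , trans (detLength²-act h₁ z₁ z₂) unimodular)
      g = h₂ ++ h₁
      located : ∀ {k} z → AtVertex k (act h₂ (act h₁ z)) → act (reverse g) (vertT k) ∼ z
      located {k} z at-k = Multiple-act⇒∼ g (subst (AtVertex k) (sym (act-++ h₂ h₁ z)) at-k)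
  in reverse g , i , j , (λ i≡j → j≢i (sym i≡j)) , located z₁ at-i , located z₂ at-j

proposition3p8 : (z₁ z₂ : Frac) → Irreducible z₁ → Irreducible z₂ →
    (IsFundamentalEdge z₁ z₂ → detLength² z₁ z₂ ≡ + 1) ×
    (detLength² z₁ z₂ ≡ + 1 → IsFundamentalEdge z₁ z₂)
proposition3p8 z₁ z₂ irr₁ irr₂ = fundamentalEdge⇒unimodular z₁ z₂ irr₁ irr₂ , unimodular⇒fundamentalEdge z₁ z₂
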